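{- Let $m\ge2$, $n\ge1$ and let $\varphi^{(n)}$ be as defined in the context. For every $(v_1,\dots,v_n)\in\{0,\dots,m-1\}^n$, the $n$-th coordinate $\widetilde{\widetilde v}_n$ of $\varphi^{(n)}(v_1,\dots,v_n)$ is $$\widetilde{\widetilde v}_n=\Bigl(v_n+\sum_{i=1}^{n-1}2^{n-1-i}v_i\Bigr)\bmod m.$$
   Context: Fix $m\ge2$. Define maps $\varphi^{(n)}:\{0,\dots,m-1\}^n\to\{0,\dots,m-1\}^n$ recursively: $\varphi^{(1)}$ is the identity, and for $n\ge2$, $\varphi^{(n)}(v_1,v_2,\dots,v_n)=\bigl(v_1,\ \varphi^{(n-1)}((v_1+v_2)\bmod m,\dots,(v_1+v_n)\bmod m)\bigr)$. -}

module Defs where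

open import Data.Nat using (ℕ; zero; suc; _+_; _*_; _^_; NonZero)
open import Data.Nat.DivMod using (_mod_)
open import Data.Fin using (Fin; toℕ)
open import Data.Vec using (Vec; []; _∷_; map; last)

addMod : (m : ℕ) .{{_ : NonZero m}} → Fin m → Fin m → Fin m
addMod m a b = (toℕ a + toℕ b) mod m

-- φ^(n) on {0,…,m-1}^n, n ≥ 1, written as Vec (Fin m) (suc k) with n = suc k
φ : (m : ℕ) .{{_ : NonZero m}} → (k : ℕ) → Vec (Fin m) (suc k) → Vec (Fin m) (suc k)
φ m zero    (v₁ ∷ [])      = v₁ ∷ []
φ m (suc k) (v₁ ∷ v₂ ∷ vs) = v₁ ∷ φ m k (map (addMod m v₁) (v₂ ∷ vs))

-- Σ_{i=1}^{n-1} 2^{n-1-i} v_i  for v = (v₁,…,v_{n-1}) given as a Vec ℕ (n-1)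
weightedSum : {j : ℕ} → Vec ℕ j → ℕ
weightedSum {zero}  []       = 0
weightedSum {suc j} (x ∷ xs) = 2 ^ j * x + weightedSum xs

-- Let W(x₁,…,xₙ) = Σ_{i<n} 2^{n-1-i} xᵢ + xₙ; its weights sum to 2^{n-1}, so adding a
-- to every coordinate adds 2^{n-1} a. Hence W(x₂+a,…,xₙ+a) = W(a,x₂,…,xₙ), i.e. W mod m is
-- unchanged by one step of the recursion, and for n = 1 it is the single coordinate.
-- So the last coordinate of φ^(n)(v) is W(v) mod m, which is the claimed formula.
module Submission where

open import Defs
open import Level using (Level)
open import Data.Nat using (ℕ; zero; suc; _+_; _*_; _^_; _%_; _≥_; NonZero)
open import Data.Nat.Properties using (+-identityʳ; *-identityˡ)
open import Data.Nat.DivMod using (_mod_; %-distribˡ-+; %-distribˡ-*; m%n%n≡m%n; m<n⇒m%n≡m)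
open import Data.Nat.Solver using (module +-*-Solver)
open import Data.Fin using (Fin; toℕ)
open import Data.Fin.Properties using (toℕ-injective; toℕ-fromℕ<; toℕ<n)
open import Data.Vec using (Vec; []; _∷_; last; init; map)
open import Data.Vec.Properties using (map-∘; map-cong)
open import Relation.Binary.PropositionalEquality
open ≡-Reasoning
open +-*-Solver

weightedSum⁺ : {k : ℕ} → Vec ℕ (suc k) → ℕ
weightedSum⁺ {zero}  (x ∷ [])     = x
weightedSum⁺ {suc k} (x ∷ y ∷ ys) = 2 ^ k * x + weightedSum⁺ (y ∷ ys)

weightedSum⁺≡last+weightedSum∘init : ∀ {k} (xs : Vec ℕ (suc k)) →
  weightedSum⁺ xs ≡ last xs + weightedSum (init xs)
weightedSum⁺≡last+weightedSum∘init {zero}  (x ∷ [])     = sym (+-identityʳ x)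
weightedSum⁺≡last+weightedSum∘init {suc k} (x ∷ y ∷ ys) = begin
  2 ^ k * x + weightedSum⁺ (y ∷ ys)
    ≡⟨ cong (2 ^ k * x +_) (weightedSum⁺≡last+weightedSum∘init (y ∷ ys)) ⟩
  2 ^ k * x + (last (y ∷ ys) + weightedSum (init (y ∷ ys)))
    ≡⟨ solve 3 (λ p l w → p :+ (l :+ w) := l :+ (p :+ w)) refl
         (2 ^ k * x) (last (y ∷ ys)) (weightedSum (init (y ∷ ys))) ⟩
  last (y ∷ ys) + (2 ^ k * x + weightedSum (init (y ∷ ys))) ∎

weightedSum⁺-map-+ : ∀ {k} a (xs : Vec ℕ (suc k)) →
  weightedSum⁺ (map (a +_) xs) ≡ 2 ^ k * a + weightedSum⁺ xs
weightedSum⁺-map-+ {zero}  a (x ∷ [])     = cong (_+ x) (sym (*-identityˡ a))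
weightedSum⁺-map-+ {suc k} a (x ∷ y ∷ ys) = begin
  2 ^ k * (a + x) + weightedSum⁺ (map (a +_) (y ∷ ys))
    ≡⟨ cong (2 ^ k * (a + x) +_) (weightedSum⁺-map-+ a (y ∷ ys)) ⟩
  2 ^ k * (a + x) + (2 ^ k * a + weightedSum⁺ (y ∷ ys))
    ≡⟨ solve 4 (λ p a x s → p :* (a :+ x) :+ (p :* a :+ s) := (con 2 :* p) :* a :+ (p :* x :+ s))
         refl (2 ^ k) a x (weightedSum⁺ (y ∷ ys)) ⟩
  2 ^ suc k * a + (2 ^ k * x + weightedSum⁺ (y ∷ ys)) ∎

last-map : ∀ {a b : Level} {A : Set a} {B : Set b} {k} (f : A → B) (xs : Vec A (suc k)) → last (map f xs) ≡ f (last xs)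
last-map {k = zero}  f (x ∷ [])     = refl
last-map {k = suc k} f (x ∷ y ∷ ys) = last-map f (y ∷ ys)

init-map : ∀ {a b : Level} {A : Set a} {B : Set b} {k} (f : A → B) (xs : Vec A (suc k)) → init (map f xs) ≡ map f (init xs)
init-map {k = zero}  f (x ∷ [])     = refl
init-map {k = suc k} f (x ∷ y ∷ ys) = cong (f x ∷_) (init-map f (y ∷ ys))

module _ (m : ℕ) .{{_ : NonZero m}} where

  weightedSum⁺-map-% : ∀ {k} (f : ℕ → ℕ) (xs : Vec ℕ (suc k)) →
    weightedSum⁺ (map (λ x → f x % m) xs) % m ≡ weightedSum⁺ (map f xs) % m
  weightedSum⁺-map-% {zero}  f (x ∷ [])     = m%n%n≡m%n (f x) m
  weightedSum⁺-map-% {suc k} f (x ∷ y ∷ ys) = begin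
    (2 ^ k * (f x % m) + weightedSum⁺ (map f′ (y ∷ ys))) % m
      ≡⟨ %-distribˡ-+ (2 ^ k * (f x % m)) _ m ⟩
    ((2 ^ k * (f x % m)) % m + weightedSum⁺ (map f′ (y ∷ ys)) % m) % m
      ≡⟨ cong₂ (λ s t → (s + t) % m) (*-%-absorb (2 ^ k) (f x)) (weightedSum⁺-map-% f (y ∷ ys)) ⟩
    ((2 ^ k * f x) % m + weightedSum⁺ (map f (y ∷ ys)) % m) % m
      ≡⟨ sym (%-distribˡ-+ (2 ^ k * f x) _ m) ⟩
    (2 ^ k * f x + weightedSum⁺ (map f (y ∷ ys))) % m ∎
    where
    f′ : ℕ → ℕ
    f′ x = f x % m

    *-%-absorb : ∀ c n → (c * (n % m)) % m ≡ (c * n) % m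
    *-%-absorb c n = begin
      (c * (n % m)) % m         ≡⟨ %-distribˡ-* c (n % m) m ⟩
      (c % m * (n % m % m)) % m ≡⟨ cong (λ r → (c % m * r) % m) (m%n%n≡m%n n m) ⟩
      (c % m * (n % m)) % m     ≡⟨ sym (%-distribˡ-* c n m) ⟩
      (c * n) % m               ∎

  map-toℕ-addMod : ∀ {k} (a : Fin m) (u : Vec (Fin m) k) →
    map toℕ (map (addMod m a) u) ≡ map (λ x → (toℕ a + x) % m) (map toℕ u)
  map-toℕ-addMod a u = begin
    map toℕ (map (addMod m a) u)                     ≡⟨ map-∘ toℕ (addMod m a) u ⟨
    map (λ x → toℕ (addMod m a x)) u                 ≡⟨ map-cong (λ x → toℕ-fromℕ< _) u ⟩
    map (λ x → (toℕ a + toℕ x) % m) u               ≡⟨ map-∘ (λ x → (toℕ a + x) % m) toℕ u ⟩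
    map (λ x → (toℕ a + x) % m) (map toℕ u)         ∎

  toℕ-last-φ : ∀ k (v : Vec (Fin m) (suc k)) →
    toℕ (last (φ m k v)) ≡ weightedSum⁺ (map toℕ v) % m
  toℕ-last-φ zero    (x ∷ [])      = sym (m<n⇒m%n≡m (toℕ<n x))
  toℕ-last-φ (suc k) (a ∷ b ∷ vs) = begin
    toℕ (last (φ m k (map (addMod m a) u)))
      ≡⟨ toℕ-last-φ k (map (addMod m a) u) ⟩
    weightedSum⁺ (map toℕ (map (addMod m a) u)) % m
      ≡⟨ cong (λ xs → weightedSum⁺ xs % m) (map-toℕ-addMod a u) ⟩
    weightedSum⁺ (map (λ x → (toℕ a + x) % m) (map toℕ u)) % m
      ≡⟨ weightedSum⁺-map-% (toℕ a +_) (map toℕ u) ⟩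
    weightedSum⁺ (map (toℕ a +_) (map toℕ u)) % m
      ≡⟨ cong (_% m) (weightedSum⁺-map-+ (toℕ a) (map toℕ u)) ⟩
    (2 ^ k * toℕ a + weightedSum⁺ (map toℕ u)) % m ∎
    where
    u : Vec (Fin m) (suc k)
    u = b ∷ vs

theorem3 : (m : ℕ) → (m≥2 : m ≥ 2) → .{{_ : NonZero m}} → (k : ℕ) → (v : Vec (Fin m) (suc k)) →
    last (φ m k v) ≡ (toℕ (last v) + weightedSum (map toℕ (init v))) mod m
theorem3 m _ k v = toℕ-injective (begin
  toℕ (last (φ m k v))                                           ≡⟨ toℕ-last-φ m k v ⟩
  weightedSum⁺ (map toℕ v) % m                                   ≡⟨ cong (_% m) (weightedSum⁺≡last+weightedSum∘init (map toℕ v)) ⟩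
  (last (map toℕ v) + weightedSum (init (map toℕ v))) % m        ≡⟨ cong₂ (λ l w → (l + weightedSum w) % m) (last-map toℕ v) (init-map toℕ v) ⟩
  (toℕ (last v) + weightedSum (map toℕ (init v))) % m            ≡⟨ toℕ-fromℕ< _ ⟨
  toℕ ((toℕ (last v) + weightedSum (map toℕ (init v))) mod m)    ∎)
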